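{- Let $k\ge2$, $\gamma\ge2$, $l\ge2$ be integers, and let $t^*$ be the smallest positive integer $t$ with $r_{\gamma-1}(t)\ge\frac{l-1}{2}$. Then $n_{dc}(k,\gamma,l)\ge t^*k$.
   Context: For a connected graph $G$ and $\emptyset\ne W\subseteq V(G)$, $\mathrm{exc}_G(W)=\max_{u\in V(G)}\min_{w\in W}d_G(u,w)$; the $j$-radius is $r_j(G)=\min\{\mathrm{exc}_G(W):W\subseteq V(G),1\le|W|\le j\}$, and $r_j(n)=\max\{r_j(T):T\text{ a tree on } n\text{ vertices}\}$. A hypergraph $\mathcal{H}$ has a finite vertex set and a family of subsets (hyperedges); it is $k$-uniform if all hyperedges have size $k$. A Berge path of length $l$ is a sequence $v_0,H_1,v_1,\dots,H_l,v_l$ with $v_{i-1},v_i\in H_i\in\mathcal{E}(\mathcal{H})$; $\mathcal{H}$ is connected if any two vertices are joined by a Berge path; $d_{\mathcal{H}}(u,v)$ is the length of a shortest Berge path, and $B_l(u)$ the set of vertices at distance at most $l$ from $u$. $D$ is distance-$l$ dominating if $\bigcup_{u\in D}B_l(u)=V(\mathcal{H})$, and $\gamma_d(\mathcal{H},l)$ is the minimum size of such $D$. $n_{dc}(k,\gamma,l)$ is the minimum number of vertices of a connected $k$-uniform hypergraph $\mathcal{H}$ with $\gamma_d(\mathcal{H},l)\ge\gamma$. -}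

module Defs where

open import Level using (0ℓ)
open import Data.Nat using (ℕ; zero; suc; _+_; _*_; _∸_; _≤_; _<_)
open import Data.Fin using (Fin)
open import Data.Fin.Subset using (Subset; _∈_; ∣_∣)
open import Data.List using (List)
import Data.List.Membership.Propositional as LM
open import Data.Product using (Σ; ∃; ∃-syntax; _×_; _,_)
open import Relation.Binary.PropositionalEquality using (_≡_)
open import Relation.Nullary using (¬_)
open import Data.Sum using (_⊎_)

record Graph (n : ℕ) : Set₁ where
  field
    Adj     : Fin n → Fin n → Set
    sym     : ∀ {u v} → Adj u v → Adj v u
    irrefl  : ∀ {u} → ¬ Adj u u
open Graph public

data Walk {n : ℕ} (A : Fin n → Fin n → Set) : Fin n → Fin n → ℕ → Set where
  here : ∀ {u} → Walk A u u 0
  step : ∀ {u v w m} → A u v → Walk A v w m → Walk A u w (suc m)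

ConnectedRel : ∀ {n} → (Fin n → Fin n → Set) → Set
ConnectedRel {n} A = ∀ (u v : Fin n) → ∃[ m ] Walk A u v m

RemoveEdge : ∀ {n} → (Fin n → Fin n → Set) → Fin n → Fin n → Fin n → Fin n → Set
RemoveEdge A a b u v = A u v × ¬ ((u ≡ a × v ≡ b) ⊎ (u ≡ b × v ≡ a))

IsTree : ∀ {n} → Graph n → Set
IsTree {n} G =
  ConnectedRel (Adj G) ×
  (∀ (a b : Fin n) → Adj G a b → ¬ (∃[ m ] Walk (RemoveEdge (Adj G) a b) a b m))

IsDist : ∀ {n} → (Fin n → Fin n → Set) → Fin n → Fin n → ℕ → Set
IsDist A u v d = Walk A u v d × (∀ m → Walk A u v m → d ≤ m)

IsMinDistTo : ∀ {n} → Graph n → Subset n → Fin n → ℕ → Set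
IsMinDistTo {n} G W u m =
  (∃[ w ] (w ∈ W × IsDist (Adj G) u w m)) ×
  (∀ (w : Fin n) → w ∈ W → ∀ d → IsDist (Adj G) u w d → m ≤ d)

IsExc : ∀ {n} → Graph n → Subset n → ℕ → Set
IsExc {n} G W e =
  (∃[ u ] IsMinDistTo G W u e) ×
  (∀ (u : Fin n) m → IsMinDistTo G W u m → m ≤ e)

IsJRadius : ∀ {n} → Graph n → ℕ → ℕ → Set
IsJRadius {n} G j r =
  (∃[ W ] (1 ≤ ∣ W ∣ × ∣ W ∣ ≤ j × IsExc G W r)) ×
  (∀ (W : Subset n) → 1 ≤ ∣ W ∣ → ∣ W ∣ ≤ j → ∀ e → IsExc G W e → r ≤ e)

IsTreeJRadius : ℕ → ℕ → ℕ → Set₁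
IsTreeJRadius j n r =
  (Σ (Graph n) λ T → IsTree T × IsJRadius T j r) ×
  (∀ (T : Graph n) → IsTree T → ∀ r′ → IsJRadius T j r′ → r′ ≤ r)

-- r_j(t) ≥ (l-1)/2, i.e. 2 r_j(t) ≥ l - 1
RAtLeastHalf : ℕ → ℕ → ℕ → Set₁
RAtLeastHalf j t l = ∃[ r ] (IsTreeJRadius j t r × l ∸ 1 ≤ 2 * r)

IsTStar : ℕ → ℕ → ℕ → Set₁
IsTStar j l t =
  1 ≤ t × RAtLeastHalf j t l × (∀ s → 1 ≤ s → s < t → ¬ RAtLeastHalf j s l)

record Hypergraph (n : ℕ) : Set where
  field
    edges : List (Subset n)
open Hypergraph public

IsUniform : ∀ {n} → ℕ → Hypergraph n → Set
IsUniform k H = ∀ e → e LM.∈ edges H → ∣ e ∣ ≡ k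

HAdj : ∀ {n} → Hypergraph n → Fin n → Fin n → Set
HAdj H u v = ∃[ e ] (e LM.∈ edges H × u ∈ e × v ∈ e)

-- Berge walks are exactly walks in HAdj
HConnected : ∀ {n} → Hypergraph n → Set
HConnected H = ConnectedRel (HAdj H)

InBall : ∀ {n} → Hypergraph n → ℕ → Fin n → Fin n → Set
InBall H l u v = ∃[ d ] (IsDist (HAdj H) u v d × d ≤ l)

IsDistDominating : ∀ {n} → Hypergraph n → ℕ → Subset n → Set
IsDistDominating {n} H l D = ∀ (v : Fin n) → ∃[ u ] (u ∈ D × InBall H l u v)

IsDistDomNumber : ∀ {n} → Hypergraph n → ℕ → ℕ → Set
IsDistDomNumber {n} H l g =
  (∃[ D ] (IsDistDominating H l D × ∣ D ∣ ≡ g)) ×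
  (∀ (D : Subset n) → IsDistDominating H l D → g ≤ ∣ D ∣)

DomAtLeast : ∀ {n} → Hypergraph n → ℕ → ℕ → Set
DomAtLeast H l γ = ∀ g → IsDistDomNumber H l g → γ ≤ g

Admissible : ∀ {n} → ℕ → ℕ → ℕ → Hypergraph n → Set
Admissible k γ l H = HConnected H × IsUniform k H × DomAtLeast H l γ

IsNdc : ℕ → ℕ → ℕ → ℕ → Set
IsNdc k γ l N =
  (Σ (Hypergraph N) λ H → Admissible k γ l H) ×
  (∀ n (H : Hypergraph n) → Admissible k γ l H → N ≤ n)

-- Grow a maximal family of pairwise disjoint hyperedges E₀, …, E_{s-1} in which every Eᵢ with
-- i > 0 is joined by a further hyperedge to an earlier E_{p(i)}.  These parent links form a tree T
-- on s vertices, and s k ≤ N because the Eᵢ are disjoint k-sets.  By maximality every vertex of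
-- the hypergraph lies within distance 1 of some Eᵢ, and a tree walk of length m lifts to a Berge
-- walk of length at most 2m + 1 between the corresponding hyperedges.  So if W realises
-- r_{γ-1}(T) and 2 r_{γ-1}(T) < l - 1, one vertex from each hyperedge named in W is a
-- distance-l dominating set of fewer than γ vertices, which is impossible.  Hence
-- r_{γ-1}(s) ≥ r_{γ-1}(T) ≥ (l - 1)/2, so t* ≤ s, and t* k ≤ s k ≤ N.
module Submission where

open import Level using (Level)
open import Function using (_∘_)
open import Data.Nat using (ℕ; zero; suc; _+_; _*_; _∸_; _≤_; _<_; _≤?_; _≟_; z≤n; s≤s)
open import Data.Nat.Properties
  using ( ≤-refl; ≤-reflexive; ≤-pred; ≤-trans; <-trans; <-irrefl; <⇒≤; <⇒≢; <⇒≱; ≰⇒>; ≮⇒≥; ≤∧≢⇒<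
        ; 1+n≰n; n≤1+n; m≤n⇒m≤1+n; m<1+n⇒m<n∨m≡n
        ; +-suc; +-comm; +-mono-≤; +-monoʳ-≤; *-monoʳ-≤; *-monoˡ-≤
        ; *-identityʳ; *-suc)
open import Data.Nat.Induction using (<-wellFounded)
open import Induction.WellFounded using (Acc; acc)
open import Data.Fin using (Fin; zero; suc; toℕ; fromℕ<)
open import Data.Fin.Properties using (toℕ-injective; toℕ<n; toℕ-fromℕ<)
open import Data.Fin.Subset using (Subset; _∈_; _∉_; ∣_∣; ⁅_⁆; _∪_; ⊤; inside; outside; Nonempty)
  renaming (⊥ to ∅)
open import Data.Fin.Subset.Properties
  using (_∈?_; x∈p∪q⁻; x∈p∪q⁺; x∈⁅x⁆; x∈⁅y⁆⇒x≡y; ∣⁅x⁆∣≡1; ∣p∣≤n; ∣⊥∣≡0; ∉⊥; ∈⊤; ∣⊤∣≡n)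
open import Data.Vec.Base using ([]; _∷_; here; there)
open import Data.List.Membership.Propositional using () renaming (_∈_ to _∈ₗ_)
open import Data.Product using (Σ; ∃; ∃-syntax; _×_; _,_; proj₁; proj₂)
import Data.Product as Product
open import Data.Sum using (_⊎_; inj₁; inj₂; [_,_])
import Data.Sum as Sum
open import Data.Empty using (⊥; ⊥-elim)
open import Relation.Nullary using (¬_; yes; no)
open import Relation.Nullary.Negation using (contradiction; negated-stable; ¬¬-map)
open import Relation.Nullary.Decidable using (decidable-stable; ¬¬-excluded-middle)
open import Relation.Binary.PropositionalEquality
  using (_≡_; refl; sym; trans; cong; cong₂; subst; subst₂)
open import Defs hiding (sym)

private
  variable
    a b : Level
    A : Set a
    B : Set b

-- Classical reasoning happens in the double-negation monad; this suffices because the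
-- final inequality is decidable.

infixl 1 _>>=_

_>>=_ : ¬ ¬ A → (A → ¬ ¬ B) → ¬ ¬ B
m >>= f = negated-stable (¬¬-map f m)

pure : A → ¬ ¬ A
pure = contradiction

IsLeast : (ℕ → Set a) → ℕ → Set a
IsLeast P m = P m × (∀ n → P n → m ≤ n)

IsGreatest : (ℕ → Set a) → ℕ → Set a
IsGreatest P m = P m × (∀ n → P n → n ≤ m)

¬¬-least : (P : ℕ → Set a) → ∀ {n} → P n → ¬ ¬ ∃ (IsLeast P)
¬¬-least P {n} Pn = least-below n (n , ≤-refl , Pn)
  where
  least-below : ∀ b → ∃[ m ] (m ≤ b × P m) → ¬ ¬ ∃ (IsLeast P)
  least-below zero (_ , z≤n , P0) = pure (0 , P0 , λ _ _ → z≤n)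
  least-below (suc b) (m , m≤1+b , Pm) = ¬¬-excluded-middle >>= λ where
    (yes smaller) → least-below b smaller
    (no none) → pure (m , Pm , λ n Pn → ≮⇒≥ λ n<m → none (n , ≤-pred (≤-trans n<m m≤1+b) , Pn))

¬¬-greatest : (P : ℕ → Set a) → ∀ b → (∀ n → P n → n ≤ b) → ∃ P → ¬ ¬ ∃ (IsGreatest P)
¬¬-greatest P zero bounded (m , Pm) with bounded m Pm
... | z≤n = pure (0 , Pm , bounded)
¬¬-greatest P (suc b) bounded ∃P = ¬¬-excluded-middle >>= λ where
  (yes P[1+b]) → pure (suc b , P[1+b] , bounded)
  (no ¬P[1+b]) → ¬¬-greatest P b (λ n Pn → ≤-pred (≤∧≢⇒< (bounded n Pn) λ { refl → ¬P[1+b] Pn })) ∃P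

¬¬-Π-Fin : ∀ {n} {P : Fin n → Set a} → (∀ i → ¬ ¬ P i) → ¬ ¬ (∀ i → P i)
¬¬-Π-Fin {n = zero} _ = pure λ ()
¬¬-Π-Fin {n = suc n} ¬¬P = do
  P0 ← ¬¬P zero
  Psuc ← ¬¬-Π-Fin (¬¬P ∘ suc)
  pure λ { zero → P0 ; (suc i) → Psuc i }

-- Finite sets

∣p∪q∣≤∣p∣+∣q∣ : ∀ {n} (p q : Subset n) → ∣ p ∪ q ∣ ≤ ∣ p ∣ + ∣ q ∣
∣p∪q∣≤∣p∣+∣q∣ [] [] = z≤n
∣p∪q∣≤∣p∣+∣q∣ (inside ∷ p) (inside ∷ q) =
  s≤s (≤-trans (∣p∪q∣≤∣p∣+∣q∣ p q) (+-monoʳ-≤ ∣ p ∣ (n≤1+n ∣ q ∣)))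
∣p∪q∣≤∣p∣+∣q∣ (inside ∷ p) (outside ∷ q) = s≤s (∣p∪q∣≤∣p∣+∣q∣ p q)
∣p∪q∣≤∣p∣+∣q∣ (outside ∷ p) (inside ∷ q) =
  ≤-trans (s≤s (∣p∪q∣≤∣p∣+∣q∣ p q)) (≤-reflexive (sym (+-suc ∣ p ∣ ∣ q ∣)))
∣p∪q∣≤∣p∣+∣q∣ (outside ∷ p) (outside ∷ q) = ∣p∪q∣≤∣p∣+∣q∣ p q

disjoint⇒∣p∪q∣≡∣p∣+∣q∣ : ∀ {n} (p q : Subset n) → (∀ {x} → x ∈ p → x ∉ q) →
                         ∣ p ∪ q ∣ ≡ ∣ p ∣ + ∣ q ∣
disjoint⇒∣p∪q∣≡∣p∣+∣q∣ [] [] _ = refl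
disjoint⇒∣p∪q∣≡∣p∣+∣q∣ (inside ∷ p) (inside ∷ q) disj = ⊥-elim (disj here here)
disjoint⇒∣p∪q∣≡∣p∣+∣q∣ (inside ∷ p) (outside ∷ q) disj =
  cong suc (disjoint⇒∣p∪q∣≡∣p∣+∣q∣ p q λ x∈p x∈q → disj (there x∈p) (there x∈q))
disjoint⇒∣p∪q∣≡∣p∣+∣q∣ (outside ∷ p) (inside ∷ q) disj =
  trans (cong suc (disjoint⇒∣p∪q∣≡∣p∣+∣q∣ p q λ x∈p x∈q → disj (there x∈p) (there x∈q)))
        (sym (+-suc ∣ p ∣ ∣ q ∣))
disjoint⇒∣p∪q∣≡∣p∣+∣q∣ (outside ∷ p) (outside ∷ q) disj =
  disjoint⇒∣p∪q∣≡∣p∣+∣q∣ p q λ x∈p x∈q → disj (there x∈p) (there x∈q)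

1≤∣p∣⇒Nonempty : ∀ {n} (p : Subset n) → 1 ≤ ∣ p ∣ → Nonempty p
1≤∣p∣⇒Nonempty (inside ∷ p) _ = zero , here
1≤∣p∣⇒Nonempty (outside ∷ p) 1≤∣p∣ = Product.map suc there (1≤∣p∣⇒Nonempty p 1≤∣p∣)

image : ∀ {m n} → (Fin m → Fin n) → Subset m → Subset n
image f [] = ∅
image f (inside ∷ p) = ⁅ f zero ⁆ ∪ image (f ∘ suc) p
image f (outside ∷ p) = image (f ∘ suc) p

∣image∣≤∣p∣ : ∀ {m n} (f : Fin m → Fin n) (p : Subset m) → ∣ image f p ∣ ≤ ∣ p ∣
∣image∣≤∣p∣ {n = n} f [] = ≤-reflexive (∣⊥∣≡0 n)
∣image∣≤∣p∣ f (inside ∷ p) =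
  ≤-trans (∣p∪q∣≤∣p∣+∣q∣ ⁅ f zero ⁆ (image (f ∘ suc) p))
          (+-mono-≤ (≤-reflexive (∣⁅x⁆∣≡1 (f zero))) (∣image∣≤∣p∣ (f ∘ suc) p))
∣image∣≤∣p∣ f (outside ∷ p) = ∣image∣≤∣p∣ (f ∘ suc) p

∈-image : ∀ {m n} (f : Fin m → Fin n) {p x} → x ∈ p → f x ∈ image f p
∈-image f {inside ∷ p} here = x∈p∪q⁺ (inj₁ (x∈⁅x⁆ (f zero)))
∈-image f {inside ∷ p} (there x∈p) = x∈p∪q⁺ {p = ⁅ f zero ⁆} (inj₂ (∈-image (f ∘ suc) x∈p))
∈-image f {outside ∷ p} (there x∈p) = ∈-image (f ∘ suc) x∈p

-- Walks

module _ {n : ℕ} {A : Fin n → Fin n → Set} where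

  infixr 5 _++ʷ_

  _++ʷ_ : ∀ {u v w m m′} → Walk A u v m → Walk A v w m′ → Walk A u w (m + m′)
  here ++ʷ q = q
  step x p ++ʷ q = step x (p ++ʷ q)

  reverseʷ : (∀ {u v} → A u v → A v u) → ∀ {u v m} → Walk A u v m → Walk A v u m
  reverseʷ symm here = here
  reverseʷ symm {m = suc m} (step x p) =
    subst (Walk A _ _) (+-comm m 1) (reverseʷ symm p ++ʷ step (symm x) here)

  ¬¬-crossing : (C : Fin n → Set) → ∀ {u v m} → Walk A u v m → ¬ C u → C v →
                ¬ ¬ (∃[ x ] ∃[ y ] (¬ C x × C y × A x y))
  ¬¬-crossing C here ¬Cu Cv = contradiction Cv ¬Cu
  ¬¬-crossing C {u} (step {v = u′} x p) ¬Cu Cv = ¬¬-excluded-middle >>= λ where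
    (yes Cu′) → pure (u , u′ , ¬Cu , Cu′ , x)
    (no ¬Cu′) → ¬¬-crossing C p ¬Cu′ Cv

  data Path : Fin n → Fin n → ℕ → Subset n → Set where
    nil  : ∀ {u} → Path u u 0 ⁅ u ⁆
    cons : ∀ {u v w m S} → A u v → u ∉ S → Path v w m S → Path u w (suc m) (⁅ u ⁆ ∪ S)

  Path⇒Walk : ∀ {u v m S} → Path u v m S → Walk A u v m
  Path⇒Walk nil = here
  Path⇒Walk (cons x _ p) = step x (Path⇒Walk p)

  Path-suffix : ∀ {x v m S u} → Path x v m S → u ∈ S → ∃[ m′ ] ∃[ S′ ] Path u v m′ S′
  Path-suffix nil u∈S rewrite x∈⁅y⁆⇒x≡y _ u∈S = _ , _ , nil
  Path-suffix (cons {u = x} {S = S} a x∉S p) u∈S with x∈p∪q⁻ ⁅ x ⁆ S u∈S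
  ... | inj₁ u∈⁅x⁆ rewrite x∈⁅y⁆⇒x≡y _ u∈⁅x⁆ = _ , _ , cons a x∉S p
  ... | inj₂ u∈S′ = Path-suffix p u∈S′

  Walk⇒Path : ∀ {u v m} → Walk A u v m → ∃[ m′ ] ∃[ S ] Path u v m′ S
  Walk⇒Path here = _ , _ , nil
  Walk⇒Path {u} (step x p) with Walk⇒Path p
  ... | _ , S , path with u ∈? S
  ...   | yes u∈S = Path-suffix path u∈S
  ...   | no u∉S = _ , _ , cons x u∉S path

  ∣Path-vertices∣ : ∀ {u v m S} → Path u v m S → ∣ S ∣ ≡ suc m
  ∣Path-vertices∣ {u} nil = ∣⁅x⁆∣≡1 u
  ∣Path-vertices∣ (cons {u = u} {S = S} _ u∉S p) =
    trans (disjoint⇒∣p∪q∣≡∣p∣+∣q∣ ⁅ u ⁆ S λ x∈⁅u⁆ → subst (_∉ S) (sym (x∈⁅y⁆⇒x≡y _ x∈⁅u⁆)) u∉S)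
          (cong₂ _+_ (∣⁅x⁆∣≡1 u) (∣Path-vertices∣ p))

  Walk-shortcut : ∀ {u v m} → Walk A u v m → ∃[ m′ ] (m′ < n × Walk A u v m′)
  Walk-shortcut w with Walk⇒Path w
  ... | m′ , S , path = m′ , subst (_≤ n) (∣Path-vertices∣ path) (∣p∣≤n S) , Path⇒Walk path

RemoveEdge-sym : ∀ {n} {A : Fin n → Fin n → Set} {a b u v} → (∀ {u v} → A u v → A v u) →
                 RemoveEdge A a b u v → RemoveEdge A a b v u
RemoveEdge-sym symm (x , not-ab) = symm x , not-ab ∘ Sum.swap ∘ Sum.map Product.swap Product.swap

-- Distances, excentricities and j-radii exist classically

¬¬-dist : ∀ {n} {A : Fin n → Fin n → Set} {u v m} → Walk A u v m →
          ¬ ¬ (∃[ d ] (IsDist A u v d × d ≤ m))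
¬¬-dist {A = A} {u} {v} {m} w = do
  (d , dist@(_ , least)) ← ¬¬-least (Walk A u v) w
  pure (d , dist , least m w)

module _ {n : ℕ} (G : Graph n) where

  minDist≤order : ∀ {W u e} → IsMinDistTo G W u e → e ≤ n
  minDist≤order ((_ , _ , walk , least) , _) =
    let (m , m<n , shortcut) = Walk-shortcut walk in ≤-trans (least m shortcut) (<⇒≤ m<n)

  jRadius≤order : ∀ {j r} → IsJRadius G j r → r ≤ n
  jRadius≤order ((_ , _ , _ , (_ , nearest) , _) , _) = minDist≤order nearest

  module _ (connected : ConnectedRel (Adj G)) where

    ¬¬-minDistTo : ∀ {W} → Nonempty W → ∀ u → ¬ ¬ ∃ (IsMinDistTo G W u)
    ¬¬-minDistTo {W} (w , w∈W) u = do
      (_ , dist , _) ← ¬¬-dist (proj₂ (connected u w))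
      (m , nearest , least) ←
        ¬¬-least (λ d → ∃[ w ] (w ∈ W × IsDist (Adj G) u w d)) (w , w∈W , dist)
      pure (m , nearest , λ w w∈W d dist → least d (w , w∈W , dist))

    ¬¬-exc : ∀ {W} → Nonempty W → ¬ ¬ ∃ (IsExc G W)
    ¬¬-exc {W} ne@(w , _) = do
      (m , nearest) ← ¬¬-minDistTo ne w
      (e , farthest , greatest) ←
        ¬¬-greatest (λ e → ∃[ u ] IsMinDistTo G W u e) n (λ _ (_ , nearest) → minDist≤order nearest)
                    (m , w , nearest)
      pure (e , farthest , λ u m nearest → greatest m (u , nearest))

    ¬¬-jRadius : ∀ {j} → 1 ≤ j → Fin n → ¬ ¬ ∃ (IsJRadius G j)
    ¬¬-jRadius {j} 1≤j x = do
      (_ , exc) ← ¬¬-exc (x , x∈⁅x⁆ x)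
      (r , optimal , least) ←
        ¬¬-least (λ r → ∃[ W ] (1 ≤ ∣ W ∣ × ∣ W ∣ ≤ j × IsExc G W r))
                 (⁅ x ⁆ , ≤-reflexive (sym ∣x∣≡1) , ≤-trans (≤-reflexive ∣x∣≡1) 1≤j , exc)
      pure (r , optimal , λ W 1≤∣W∣ ∣W∣≤j e exc → least e (W , 1≤∣W∣ , ∣W∣≤j , exc))
      where
      ∣x∣≡1 : ∣ ⁅ x ⁆ ∣ ≡ 1
      ∣x∣≡1 = ∣⁅x⁆∣≡1 x

¬¬-treeJRadius : ∀ {j s r} (T : Graph s) → IsTree T → IsJRadius T j r →
                 ¬ ¬ (∃[ R ] (IsTreeJRadius j s R × r ≤ R))
¬¬-treeJRadius {j} {s} {r} T tree jr = do
  (R , optimal , greatest) ←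
    ¬¬-greatest (λ r → Σ (Graph s) λ T → IsTree T × IsJRadius T j r) s
                (λ _ (T , _ , jr) → jRadius≤order T jr) (r , T , tree , jr)
  pure (R , (optimal , λ T tree r jr → greatest r (T , tree , jr)) , greatest r (T , tree , jr))

module _ {N : ℕ} (H : Hypergraph N) where

  ⊤-dominating : ∀ {l} → IsDistDominating H l ⊤
  ⊤-dominating v = v , ∈⊤ , 0 , (here , λ _ _ → z≤n) , z≤n

  DomAtLeast⇒≤∣dominating∣ : ∀ {l γ D} → DomAtLeast H l γ → IsDistDominating H l D → γ ≤ ∣ D ∣
  DomAtLeast⇒≤∣dominating∣ {l} {γ} {D} γ≤γd dominating = decidable-stable (γ ≤? ∣ D ∣) do
    (g , optimal , least) ←
      ¬¬-least (λ g → ∃[ D ] (IsDistDominating H l D × ∣ D ∣ ≡ g)) (D , dominating , refl)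
    let γd = optimal , λ D dominating → least ∣ D ∣ (D , dominating , refl)
    pure (≤-trans (γ≤γd g γd) (least ∣ D ∣ (D , dominating , refl)))

-- The tree of a parent function on {0, …, s-1}

module ParentTree (s : ℕ) (parent : ℕ → ℕ) (parent< : ∀ {i} → i < s → 0 < i → parent i < i) where

  ChildOf : Fin s → Fin s → Set
  ChildOf c p = 0 < toℕ c × toℕ p ≡ parent (toℕ c)

  TreeAdj : Fin s → Fin s → Set
  TreeAdj x y = ChildOf y x ⊎ ChildOf x y

  parent-unique : ∀ {c p p′} → ChildOf c p → ChildOf c p′ → p ≡ p′
  parent-unique (_ , p≡) (_ , p′≡) = toℕ-injective (trans p≡ (sym p′≡))

  parent<child : ∀ {c p} → ChildOf c p → toℕ p < toℕ c
  parent<child {c} (0<c , p≡) = subst (_< toℕ c) (sym p≡) (parent< (toℕ<n c) 0<c)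

  tree : Graph s
  tree = record
    { Adj = TreeAdj
    ; sym = Sum.swap
    ; irrefl = [ not-own-child , not-own-child ]
    }
    where
    not-own-child : ∀ {x} → ¬ ChildOf x x
    not-own-child x-x = <-irrefl refl (parent<child x-x)

  walk-to-root : ∀ x → ∃[ r ] (toℕ r ≡ 0 × ∃[ m ] Walk TreeAdj x r m)
  walk-to-root x = go x (<-wellFounded (toℕ x))
    where
    go : ∀ x → Acc _<_ (toℕ x) → ∃[ r ] (toℕ r ≡ 0 × ∃[ m ] Walk TreeAdj x r m)
    go x (acc smaller) with toℕ x in x≡
    ... | zero = x , x≡ , 0 , here
    ... | suc _ =
      let 0<x = subst (0 <_) (sym x≡) (s≤s z≤n)
          p<s = <-trans (parent< (toℕ<n x) 0<x) (toℕ<n x)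
          p = fromℕ< p<s
          x-p = 0<x , toℕ-fromℕ< p<s
          (r , r≡0 , m , p→r) = go p (smaller (subst (toℕ p <_) x≡ (parent<child x-p)))
      in r , r≡0 , suc m , step (inj₂ x-p) p→r

  connected : ConnectedRel TreeAdj
  connected u v =
    let (r , r≡0 , m , u→r) = walk-to-root u
        (r′ , r′≡0 , m′ , v→r′) = walk-to-root v
        r′≡r = toℕ-injective (trans r′≡0 (sym r≡0))
    in m + m′ , u→r ++ʷ reverseʷ Sum.swap (subst (λ r → Walk TreeAdj v r m′) r′≡r v→r′)

  data Descendant (c : Fin s) : Fin s → Set where
    self  : Descendant c c
    child : ∀ {x p} → ChildOf x p → Descendant c p → Descendant c x

  descendant⇒≥ : ∀ {c x} → Descendant c x → toℕ c ≤ toℕ x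
  descendant⇒≥ self = ≤-refl
  descendant⇒≥ (child x-p d) = ≤-trans (descendant⇒≥ d) (<⇒≤ (parent<child x-p))

  descendant-preserved : ∀ {a b c p} → ChildOf c p → (c ≡ a × p ≡ b) ⊎ (c ≡ b × p ≡ a) →
    ∀ {x y m} → Walk (RemoveEdge TreeAdj a b) x y m → Descendant c x → Descendant c y
  descendant-preserved c-p removed here d = d
  descendant-preserved c-p removed (step (inj₁ y-x , _) w) d =
    descendant-preserved c-p removed w (child y-x d)
  descendant-preserved {a} {b} {c} c-p removed (step (inj₂ c-y , kept) w) self =
    ⊥-elim (kept (subst (λ y → (c ≡ a × y ≡ b) ⊎ (c ≡ b × y ≡ a)) (parent-unique c-p c-y) removed))
  descendant-preserved c-p removed (step (inj₂ x-y , _) w) (child x-p′ d) =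
    descendant-preserved c-p removed w (subst (Descendant _) (parent-unique x-p′ x-y) d)

  parent-not-descendant : ∀ {c p} → ChildOf c p → ¬ Descendant c p
  parent-not-descendant c-p d = <⇒≱ (parent<child c-p) (descendant⇒≥ d)

  minimally-connected : ∀ a b → TreeAdj a b → ¬ (∃[ m ] Walk (RemoveEdge TreeAdj a b) a b m)
  minimally-connected a b (inj₁ b-a) (_ , a→b) =
    parent-not-descendant b-a
      (descendant-preserved b-a (inj₂ (refl , refl)) (reverseʷ (RemoveEdge-sym Sum.swap) a→b) self)
  minimally-connected a b (inj₂ a-b) (_ , a→b) =
    parent-not-descendant a-b (descendant-preserved a-b (inj₁ (refl , refl)) a→b self)

  tree-IsTree : IsTree tree
  tree-IsTree = connected , minimally-connected

-- Trees of pairwise disjoint hyperedges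

HAdj-sym : ∀ {N} {H : Hypergraph N} {x y} → HAdj H x y → HAdj H y x
HAdj-sym (e , e∈H , x∈e , y∈e) = e , e∈H , y∈e , x∈e

edge-exists : ∀ {N} (H : Hypergraph N) → HConnected H → 2 ≤ N → ∃ (_∈ₗ edges H)
edge-exists {suc (suc _)} H connected (s≤s (s≤s _)) with connected zero (suc zero)
... | _ , step (e , e∈H , _) _ = e , e∈H

_[_]≔_ : (ℕ → A) → ℕ → A → ℕ → A
(f [ s ]≔ x) i with i ≟ s
... | yes _ = x
... | no _ = f i

[]≔-updated : ∀ (f : ℕ → A) s x → (f [ s ]≔ x) s ≡ x
[]≔-updated f s x with s ≟ s
... | yes _ = refl
... | no s≢s = contradiction refl s≢s

[]≔-unchanged : ∀ (f : ℕ → A) {s i} x → i < s → (f [ s ]≔ x) i ≡ f i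
[]≔-unchanged f {s} {i} x i<s with i ≟ s
... | yes i≡s = contradiction i≡s (<⇒≢ i<s)
... | no _ = refl

module EdgeTrees {N : ℕ} (H : Hypergraph N) where

  Linked : Subset N → Subset N → Set
  Linked e e′ = ∃[ x ] ∃[ y ] (x ∈ e × y ∈ e′ × HAdj H x y)

  record DisjointEdgeTree (s : ℕ) : Set where
    field
      edge     : ℕ → Subset N
      parent   : ℕ → ℕ
      edge∈H   : ∀ {i} → i < s → edge i ∈ₗ edges H
      disjoint : ∀ {i j x} → i < s → j < s → x ∈ edge i → x ∈ edge j → i ≡ j
      parent<  : ∀ {i} → i < s → 0 < i → parent i < i
      linked   : ∀ {i} → i < s → 0 < i → Linked (edge i) (edge (parent i))

  open DisjointEdgeTree

  module TreeOf {s} (T : DisjointEdgeTree s) = ParentTree s (parent T) (parent< T)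

  empty : DisjointEdgeTree 0
  empty = record
    { edge = λ _ → ∅ ; parent = λ _ → 0
    ; edge∈H = λ () ; disjoint = λ () ; parent< = λ () ; linked = λ ()
    }

  extend : ∀ {s} (T : DisjointEdgeTree s) {g} → g ∈ₗ edges H →
           (∀ {j x} → j < s → x ∈ g → x ∉ edge T j) →
           (p : ℕ) → (0 < s → p < s × Linked g (edge T p)) → DisjointEdgeTree (suc s)
  extend {s} T {g} g∈H fresh p attach = record
    { edge = edge′ ; parent = parent′
    ; edge∈H = edge∈H′ ; disjoint = disjoint′ ; parent< = parent<′ ; linked = linked′
    }
    where
    edge′ : ℕ → Subset N
    edge′ = edge T [ s ]≔ g

    parent′ : ℕ → ℕ
    parent′ = parent T [ s ]≔ p

    old-edge : ∀ {i} → i < s → edge′ i ≡ edge T i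
    old-edge = []≔-unchanged (edge T) g

    new-edge : edge′ s ≡ g
    new-edge = []≔-updated (edge T) s g

    old-parent : ∀ {i} → i < s → parent′ i ≡ parent T i
    old-parent = []≔-unchanged (parent T) p

    new-parent : parent′ s ≡ p
    new-parent = []≔-updated (parent T) s p

    ∈-old : ∀ {i x} → i < s → x ∈ edge′ i → x ∈ edge T i
    ∈-old {x = x} i<s = subst (x ∈_) (old-edge i<s)

    ∈-new : ∀ {x} → x ∈ edge′ s → x ∈ g
    ∈-new {x} = subst (x ∈_) new-edge

    edge∈H′ : ∀ {i} → i < suc s → edge′ i ∈ₗ edges H
    edge∈H′ i<1+s with m<1+n⇒m<n∨m≡n i<1+s
    ... | inj₁ i<s = subst (_∈ₗ edges H) (sym (old-edge i<s)) (edge∈H T i<s)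
    ... | inj₂ refl = subst (_∈ₗ edges H) (sym new-edge) g∈H

    disjoint′ : ∀ {i j x} → i < suc s → j < suc s → x ∈ edge′ i → x ∈ edge′ j → i ≡ j
    disjoint′ i<1+s j<1+s x∈i x∈j with m<1+n⇒m<n∨m≡n i<1+s | m<1+n⇒m<n∨m≡n j<1+s
    ... | inj₁ i<s  | inj₁ j<s  = disjoint T i<s j<s (∈-old i<s x∈i) (∈-old j<s x∈j)
    ... | inj₁ i<s  | inj₂ refl = ⊥-elim (fresh i<s (∈-new x∈j) (∈-old i<s x∈i))
    ... | inj₂ refl | inj₁ j<s  = ⊥-elim (fresh j<s (∈-new x∈i) (∈-old j<s x∈j))
    ... | inj₂ refl | inj₂ refl = refl

    parent<′ : ∀ {i} → i < suc s → 0 < i → parent′ i < i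
    parent<′ {i} i<1+s 0<i with m<1+n⇒m<n∨m≡n i<1+s
    ... | inj₁ i<s = subst (_< i) (sym (old-parent i<s)) (parent< T i<s 0<i)
    ... | inj₂ refl = subst (_< s) (sym new-parent) (proj₁ (attach 0<i))

    linked′ : ∀ {i} → i < suc s → 0 < i → Linked (edge′ i) (edge′ (parent′ i))
    linked′ i<1+s 0<i with m<1+n⇒m<n∨m≡n i<1+s
    ... | inj₁ i<s =
      let parent<s = <-trans (parent< T i<s 0<i) i<s in
      subst₂ Linked (sym (old-edge i<s))
             (sym (trans (cong edge′ (old-parent i<s)) (old-edge parent<s)))
             (linked T i<s 0<i)
    ... | inj₂ refl =
      let (p<s , g-p) = attach 0<i in
      subst₂ Linked (sym new-edge) (sym (trans (cong edge′ new-parent) (old-edge p<s))) g-p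

  module _ {s} (T : DisjointEdgeTree s) where

    ⋃edges< : ℕ → Subset N
    ⋃edges< zero = ∅
    ⋃edges< (suc i) = edge T i ∪ ⋃edges< i

    ∈⋃edges< : ∀ {i x} → x ∈ ⋃edges< i → ∃[ j ] (j < i × x ∈ edge T j)
    ∈⋃edges< {zero} x∈∅ = ⊥-elim (∉⊥ x∈∅)
    ∈⋃edges< {suc i} x∈⋃ with x∈p∪q⁻ (edge T i) (⋃edges< i) x∈⋃
    ... | inj₁ x∈i = i , ≤-refl , x∈i
    ... | inj₂ x∈⋃′ = Product.map₂ (Product.map₁ m≤n⇒m≤1+n) (∈⋃edges< x∈⋃′)

    ∣⋃edges<∣ : ∀ {k} → IsUniform k H → ∀ {i} → i ≤ s → ∣ ⋃edges< i ∣ ≡ i * k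
    ∣⋃edges<∣ uniform {zero} _ = ∣⊥∣≡0 N
    ∣⋃edges<∣ uniform {suc i} i<s =
      trans (disjoint⇒∣p∪q∣≡∣p∣+∣q∣ (edge T i) (⋃edges< i) λ x∈i x∈⋃ →
               let (j , j<i , x∈j) = ∈⋃edges< x∈⋃ in
               <⇒≢ j<i (disjoint T (<-trans j<i i<s) i<s x∈j x∈i))
            (cong₂ _+_ (uniform _ (edge∈H T i<s)) (∣⋃edges<∣ uniform (<⇒≤ i<s)))

    size : ∀ {k} → IsUniform k H → s * k ≤ N
    size uniform = subst (_≤ N) (∣⋃edges<∣ uniform ≤-refl) (∣p∣≤n (⋃edges< s))

  IsMaximal : ∀ {s} → DisjointEdgeTree s → Set
  IsMaximal {s} _ = ∀ {s′} → DisjointEdgeTree s′ → s′ ≤ s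

  ¬¬-maximal : ∀ {k} → IsUniform k H → 1 ≤ k → ¬ ¬ (∃[ s ] Σ (DisjointEdgeTree s) IsMaximal)
  ¬¬-maximal uniform 1≤k = do
    (s , T , greatest) ← ¬¬-greatest DisjointEdgeTree N s≤N (0 , empty)
    pure (s , T , λ {s′} → greatest s′)
    where
    s≤N : ∀ s → DisjointEdgeTree s → s ≤ N
    s≤N s T = ≤-trans (≤-trans (≤-reflexive (sym (*-identityʳ s))) (*-monoʳ-≤ s 1≤k))
                      (size T uniform)

  maximal⇒positive : ∀ {s} (T : DisjointEdgeTree s) → IsMaximal T → ∀ {e} → e ∈ₗ edges H → 0 < s
  maximal⇒positive {zero} T maximal e∈H = maximal (extend T e∈H (λ ()) 0 (λ ()))
  maximal⇒positive {suc s} _ _ _ = s≤s z≤n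

  Touches : ∀ {s} → DisjointEdgeTree s → Fin N → Set
  Touches {s} T v = ∃[ i ] (i < s × ∃[ z ] (z ∈ edge T i × HAdj H z v))

  module _ (H-connected : HConnected H) (nonempty : ∀ {e} → e ∈ₗ edges H → Nonempty e)
           {s} (T : DisjointEdgeTree s) (maximal : IsMaximal T) (0<s : 0 < s) where

    open TreeOf T

    -- Were v untouched, a walk from v to the root edge would contain a hyperedge from an
    -- untouched to a touched vertex, and that hyperedge could be added to T.
    maximal⇒touches : ∀ v → ¬ ¬ Touches T v
    maximal⇒touches v ¬touched-v =
      ¬¬-crossing (Touches T) (proj₂ (H-connected v x)) ¬touched-v x-touched
        λ (u , u′ , ¬touched-u , (i , i<s , z , z∈i , z-u′) , (g , g∈H , u∈g , u′∈g)) →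
          let fresh : ∀ {j y} → j < s → y ∈ g → y ∉ edge T j
              fresh {j} {y} j<s y∈g y∈j = ¬touched-u (j , j<s , y , y∈j , g , g∈H , y∈g , u∈g)
          in 1+n≰n (maximal (extend T g∈H fresh i λ _ → i<s , u′ , z , u′∈g , z∈i , HAdj-sym z-u′))
      where
      x : Fin N
      x = proj₁ (nonempty (edge∈H T 0<s))
      x∈root : x ∈ edge T 0
      x∈root = proj₂ (nonempty (edge∈H T 0<s))
      x-touched : Touches T x
      x-touched = 0 , 0<s , x , x∈root , edge T 0 , edge∈H T 0<s , x∈root , x∈root

    lift : ∀ {i j m} → Walk TreeAdj i j m → ∀ {x z v} → x ∈ edge T (toℕ i) → z ∈ edge T (toℕ j) →
           HAdj H z v → Walk (HAdj H) x v (2 + 2 * m)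
    lift {i} here x∈i z∈i z-v =
      step (edge T (toℕ i) , edge∈H T (toℕ<n i) , x∈i , z∈i) (step z-v here)
    lift {i} {m = suc m} (step {v = j} (inj₁ (0<j , i≡)) w) x∈i z∈ z-v =
      let (y , y′ , y∈j , y′∈i , y-y′) = linked T (toℕ<n j) 0<j
          y′∈i = subst (λ p → y′ ∈ edge T p) (sym i≡) y′∈i
      in subst (Walk (HAdj H) _ _) (cong (2 +_) (sym (*-suc 2 m)))
           (step (edge T (toℕ i) , edge∈H T (toℕ<n i) , x∈i , y′∈i)
             (step (HAdj-sym y-y′) (lift w y∈j z∈ z-v)))
    lift {i} {m = suc m} (step {v = j} (inj₂ (0<i , j≡)) w) x∈i z∈ z-v =
      let (y , y′ , y∈i , y′∈j , y-y′) = linked T (toℕ<n i) 0<i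
          y′∈j = subst (λ p → y′ ∈ edge T p) (sym j≡) y′∈j
      in subst (Walk (HAdj H) _ _) (cong (2 +_) (sym (*-suc 2 m)))
           (step (edge T (toℕ i) , edge∈H T (toℕ<n i) , x∈i , y∈i)
             (step y-y′ (lift w y′∈j z∈ z-v)))

    representative : Fin s → Fin N
    representative i = proj₁ (nonempty (edge∈H T (toℕ<n i)))

    representatives-dominate : ∀ {W r l} → IsExc tree W r → 2 + 2 * r ≤ l →
                               ¬ ¬ IsDistDominating H l (image representative W)
    representatives-dominate ((_ , (w₀ , w₀∈W , _) , _) , farthest) 2+2r≤l = ¬¬-Π-Fin λ v → do
      (i , i<s , z , z∈i , z-v) ← maximal⇒touches v
      let y = fromℕ< i<s
          z∈y = subst (λ j → z ∈ edge T j) (sym (toℕ-fromℕ< i<s)) z∈i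
      (m , nearest@((w , w∈W , y→w , _) , _)) ← ¬¬-minDistTo tree connected (w₀ , w₀∈W) y
      let w∈w = proj₂ (nonempty (edge∈H T (toℕ<n w)))
      (d , dist , d≤) ← ¬¬-dist (lift (reverseʷ Sum.swap y→w) w∈w z∈y z-v)
      pure ( representative w , ∈-image representative w∈W , d , dist
           , ≤-trans d≤ (≤-trans (+-monoʳ-≤ 2 (*-monoʳ-≤ 2 (farthest y m nearest))) 2+2r≤l))

tStar≤order : ∀ {j l t s r} → IsTStar j l t → 1 ≤ s → (T : Graph s) → IsTree T → IsJRadius T j r →
              l ∸ 1 ≤ 2 * r → ¬ ¬ (t ≤ s)
tStar≤order (_ , _ , t-least) 1≤s T tree jr l∸1≤2r = do
  (R , r[s]≡R , r≤R) ← ¬¬-treeJRadius T tree jr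
  pure (≮⇒≥ λ s<t → t-least _ 1≤s s<t (R , r[s]≡R , ≤-trans l∸1≤2r (*-monoʳ-≤ 2 r≤R)))

l∸1≰2r⇒2+2r≤l : ∀ l r → ¬ (l ∸ 1 ≤ 2 * r) → 2 + 2 * r ≤ l
l∸1≰2r⇒2+2r≤l zero r l∸1≰2r = contradiction z≤n l∸1≰2r
l∸1≰2r⇒2+2r≤l (suc l) r l∸1≰2r = s≤s (≰⇒> l∸1≰2r)

lemma2 : ∀ (k γ l : ℕ) → 2 ≤ k → 2 ≤ γ → 2 ≤ l →
    ∀ (t : ℕ) → IsTStar (γ ∸ 1) l t →
    ∀ (N : ℕ) → IsNdc k γ l N → t * k ≤ N
lemma2 k γ l 2≤k 2≤γ@(s≤s 1≤γ∸1) _ t tStar N ((H , H-connected , uniform , γ≤γd) , _) =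
  decidable-stable (t * k ≤? N) do
    (s , T , maximal) ← ¬¬-maximal uniform 1≤k
    let 0<s = maximal⇒positive T maximal (proj₂ (edge-exists H H-connected 2≤N))
        open TreeOf T
    (r , jr@((W , _ , ∣W∣≤γ∸1 , exc) , _)) ← ¬¬-jRadius tree connected 1≤γ∸1 (fromℕ< 0<s)
    t≤s ← ¬¬-excluded-middle >>= λ where
      (yes l∸1≤2r) → tStar≤order {l = l} tStar 0<s tree tree-IsTree jr l∸1≤2r
      (no l∸1≰2r) → do
        dominating ← representatives-dominate H-connected nonempty T maximal 0<s exc
                       (l∸1≰2r⇒2+2r≤l l r l∸1≰2r)
        contradiction (≤-trans (DomAtLeast⇒≤∣dominating∣ H γ≤γd dominating)
                               (≤-trans (∣image∣≤∣p∣ _ W) ∣W∣≤γ∸1)) 1+n≰n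
    pure (≤-trans (*-monoˡ-≤ k t≤s) (size T uniform))
  where
  open EdgeTrees H
  1≤k : 1 ≤ k
  1≤k = <⇒≤ 2≤k
  2≤N : 2 ≤ N
  2≤N = ≤-trans 2≤γ (subst (γ ≤_) (∣⊤∣≡n N) (DomAtLeast⇒≤∣dominating∣ H γ≤γd (⊤-dominating H)))
  nonempty : ∀ {e} → e ∈ₗ edges H → Nonempty e
  nonempty e∈H = 1≤∣p∣⇒Nonempty _ (subst (1 ≤_) (sym (uniform _ e∈H)) 1≤k)
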